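{- Let $\mathcal{H}$ be a hereditary family of graphs, let $k\ge2$ be an integer and $\alpha(k)\in\mathbb{N}$. Let $G$ be an $(\alpha(k),k)$-unbreakable graph with more than $3(\alpha(k)+k)$ vertices, and let $(T,\chi,L)$ be an $\mathcal{H}$-tree decomposition of $G$ of width at most $k-1$. Then $G[L]$ has a connected component with at least $\alpha(k)$ vertices.
   Context: A separation of $G$ is a pair $(X,Y)$ with $X\cup Y=V(G)$ and no edge between $X\setminus Y$ and $Y\setminus X$; its order is $|X\cap Y|$. $G$ is $(s,c)$-unbreakable if there is no separation $(X,Y)$ of order at most $c$ with $|X\setminus Y|\ge s$ and $|Y\setminus X|\ge s$. Hereditary: closed under induced subgraphs. An $\mathcal{H}$-tree decomposition of $G$ is $(T,\chi,L)$ with $L\subseteq V(G)$, $T$ a rooted tree, $\chi:V(T)\to2^{V(G)}$, such that: for each $v\in V(G)$ the nodes $t$ with $v\in\chi(t)$ form a non-empty connected subtree; every edge has both endpoints in some bag; for each $v\in L$ there is a unique $t$ with $v\in\chi(t)$, and $t$ is a leaf; for every node $t$, $G[\chi(t)\cap L]\in\mathcal{H}$. Width $=\max(0,\max_t|\chi(t)\setminus L|-1)$. -}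

module Defs where

open import Data.Nat using (ℕ; zero; suc; _≤_; _<_; _∸_)
open import Data.Fin using (Fin)
open import Data.Fin.Subset using (Subset; _∈_; _∉_; _⊆_; _∩_; _∪_; _─_; ∣_∣; ⊤; Nonempty)
open import Data.Vec using (tabulate; lookup)
open import Data.Bool using (Bool; true; false)
open import Data.Product using (Σ; ∃; ∃-syntax; _×_; _,_)
open import Data.Sum using (_⊎_)
open import Relation.Binary.PropositionalEquality using (_≡_; _≢_)
open import Relation.Nullary using (¬_)
open import Function.Definitions using (Injective)

record Graph : Set where
  field
    n     : ℕ
    adj   : Fin n → Fin n → Bool
    sym   : ∀ x y → adj x y ≡ adj y x
    irrefl : ∀ x → adj x x ≡ false

open Graph public

Edge : (G : Graph) → Fin (n G) → Fin (n G) → Set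
Edge G x y = adj G x y ≡ true

data WalkIn {m : ℕ} (A : Fin m → Fin m → Set) (S : Subset m) : Fin m → Fin m → Set where
  here : ∀ {x} → x ∈ S → WalkIn A S x x
  step : ∀ {x y z} → x ∈ S → A x y → WalkIn A S y z → WalkIn A S x z

ConnectedIn : {m : ℕ} → (Fin m → Fin m → Set) → Subset m → Set
ConnectedIn A S = Nonempty S × (∀ x y → x ∈ S → y ∈ S → WalkIn A S x y)

IsInducedOn : (G : Graph) → Subset (n G) → Graph → Set
IsInducedOn G S G' =
  Σ (Fin (n G') → Fin (n G)) λ f →
    Injective _≡_ _≡_ f
    × (∀ v → v ∈ S → ∃[ i ] f i ≡ v)
    × (∀ i → f i ∈ S)
    × (∀ i j → adj G' i j ≡ adj G (f i) (f j))

IsInducedSubgraph : Graph → Graph → Set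
IsInducedSubgraph G' G = Σ (Subset (n G)) λ S → IsInducedOn G S G'

Hereditary : (Graph → Set) → Set
Hereditary ℋ = ∀ G G' → ℋ G → IsInducedSubgraph G' G → ℋ G'

InducedIn : (ℋ : Graph → Set) (G : Graph) → Subset (n G) → Set
InducedIn ℋ G S = Σ Graph λ G' → IsInducedOn G S G' × ℋ G'

IsSeparation : (G : Graph) → Subset (n G) → Subset (n G) → Set
IsSeparation G X Y =
  (∀ v → v ∈ (X ∪ Y))
  × (∀ x y → x ∈ (X ─ Y) → y ∈ (Y ─ X) → ¬ Edge G x y)

order : (G : Graph) → Subset (n G) → Subset (n G) → ℕ
order G X Y = ∣ X ∩ Y ∣

Unbreakable : ℕ → ℕ → Graph → Set
Unbreakable s c G =
  ¬ (Σ (Subset (n G)) λ X → Σ (Subset (n G)) λ Y →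
       IsSeparation G X Y × order G X Y ≤ c
       × s ≤ ∣ X ─ Y ∣ × s ≤ ∣ Y ─ X ∣)

-- Rooted trees, represented by a root and a parent function with a
-- strictly decreasing depth (the root is its own parent).

record RootedTree : Set where
  field
    size   : ℕ
    root   : Fin size
    parent : Fin size → Fin size
    depth  : Fin size → ℕ
    root-parent : parent root ≡ root
    depth-dec   : ∀ t → t ≢ root → depth (parent t) < depth t

open RootedTree public

TreeAdj : (T : RootedTree) → Fin (size T) → Fin (size T) → Set
TreeAdj T s t = (s ≢ root T × parent T s ≡ t) ⊎ (t ≢ root T × parent T t ≡ s)

IsLeaf : (T : RootedTree) → Fin (size T) → Set
IsLeaf T t = ∀ s → s ≢ root T → parent T s ≢ t

record HTreeDecomposition (ℋ : Graph → Set) (G : Graph) : Set where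
  field
    L    : Subset (n G)
    tree : RootedTree
    χ    : Fin (size tree) → Subset (n G)
    -- for each vertex, the nodes whose bag contains it form a
    -- non-empty connected subtree
    vertex-connected : ∀ v → ConnectedIn (TreeAdj tree) (tabulate λ t → lookup (χ t) v)
    edge-covered : ∀ x y → Edge G x y → ∃[ t ] (x ∈ χ t × y ∈ χ t)
    L-leaf : ∀ v → v ∈ L →
      ∃[ t ] (v ∈ χ t × IsLeaf tree t × (∀ t' → v ∈ χ t' → t' ≡ t))
    bags-in-ℋ : ∀ t → InducedIn ℋ G (χ t ∩ L)

open HTreeDecomposition public

-- width(D) ≤ w, where width = max(0, max_t |χ(t) ∖ L| - 1)
WidthAtMost : {ℋ : Graph → Set} {G : Graph} → HTreeDecomposition ℋ G → ℕ → Set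
WidthAtMost D w = ∀ t → ∣ χ D t ─ L D ∣ ∸ 1 ≤ w

IsComponentOf : (G : Graph) → Subset (n G) → Subset (n G) → Set
IsComponentOf G S C =
  C ⊆ S
  × ConnectedIn (Edge G) C
  × (∀ x y → x ∈ C → y ∈ S → Edge G x y → y ∈ C)

{-# OPTIONS --safe #-}

-- Let A(t) be the vertices all of whose bags lie in the subtree of t, and choose a
-- deepest node t with ∣A(t)∣ ≥ α. Cutting the tree edge above t separates A(t) from the
-- vertices with no bag below t through the non-L vertices of χ(t), at most k of them,
-- so by unbreakability the latter side has fewer than α vertices. Unbreakability also
-- gives a component K of G − (χ(t) ∖ L) with at least α vertices. If K meets χ(t) it
-- consists of L-vertices whose only bag is t, hence is a component of G[L]; otherwise
-- K is connected and avoids χ(t), so it lies on one side of the cut at t or at a child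
-- of t, and either way its size contradicts the choice of t.

module Submission where

open import Defs hiding (sym)
open import Data.Bool using (Bool; true; false)
open import Data.Fin using (Fin; _≟_)
open import Data.Fin.Properties using (any?)
open import Data.Fin.Subset
  using (Subset; _∈_; _∉_; _⊆_; _⊂_; _∩_; _∪_; _─_; ∁; ⁅_⁆; ⋃; ∣_∣; Nonempty; ⊤)
  renaming (⊥ to ∅)
open import Data.Fin.Subset.Properties
open import Data.List using (List; []; _∷_; map; filter; allFin)
import Data.List.Membership.Propositional as List
open import Data.List.Membership.Propositional.Properties using (∈-filter⁺; ∈-allFin)
import Data.List.Relation.Unary.All as All
open import Data.List.Relation.Unary.All.Properties using (all-filter)
import Data.List.Relation.Unary.Any as Any
open import Data.List.Extrema.Nat using (argmax; argmax-all; f[xs]≤f[argmax])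
open import Data.Nat using (ℕ; zero; suc; _≤_; _<_; _+_; _*_; _∸_; z≤n; s≤s; _≤?_)
open import Data.Nat.GeneralisedArithmetic using (fold; iterate)
open import Data.Nat.Properties hiding (_≟_)
open import Data.Nat.Tactic.RingSolver using (solve-∀)
open import Data.Product using (Σ; ∃; _×_; _,_; proj₁; proj₂)
open import Data.Empty using (⊥)
open import Data.Sum using (_⊎_; inj₁; inj₂)
open import Data.Vec using ([]; _∷_; here; there; tabulate; lookup)
open import Data.Vec.Properties using (lookup∘tabulate; []=⇒lookup; lookup⇒[]=)
open import Function using (_∘_)
open import Level using (Level)
open import Relation.Binary.PropositionalEquality using (_≡_; _≢_; refl; sym; trans; subst; cong)
open import Relation.Nullary using (Dec; yes; no; does; ¬_; contradiction)
open import Relation.Nullary.Decidable using (_×-dec_; _⊎-dec_; ¬?; dec-true; map′)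
open import Relation.Unary using (Pred; Decidable)

private
  variable
    a ℓ : Level
    m : ℕ

∈-tabulate⁺ : {f : Fin m → Bool} {x : Fin m} → f x ≡ true → x ∈ tabulate f
∈-tabulate⁺ {f = f} {x} fx≡true = lookup⇒[]= x (tabulate f) (trans (lookup∘tabulate f x) fx≡true)

∈-tabulate⁻ : {f : Fin m → Bool} {x : Fin m} → x ∈ tabulate f → f x ≡ true
∈-tabulate⁻ {f = f} {x} x∈ = trans (sym (lookup∘tabulate f x)) ([]=⇒lookup x∈)

fromDec : {P : Pred (Fin m) ℓ} → Decidable P → Subset m
fromDec P? = tabulate (does ∘ P?)

∈-fromDec⁺ : {P : Pred (Fin m) ℓ} (P? : Decidable P) {x : Fin m} → P x → x ∈ fromDec P?
∈-fromDec⁺ P? {x} px = ∈-tabulate⁺ (dec-true (P? x) px)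

∈-fromDec⁻ : {P : Pred (Fin m) ℓ} (P? : Decidable P) {x : Fin m} → x ∈ fromDec P? → P x
∈-fromDec⁻ P? {x} x∈ = true⇒witness (P? x) (∈-tabulate⁻ x∈)
  where
  true⇒witness : ∀ {A : Set ℓ} (A? : Dec A) → does A? ≡ true → A
  true⇒witness (yes a) _ = a

x∈p─q⇒x∉q : {x : Fin m} (p q : Subset m) → x ∈ p ─ q → x ∉ q
x∈p─q⇒x∉q (_ ∷ p) (false ∷ q) here = λ ()
x∈p─q⇒x∉q (_ ∷ p) (_ ∷ q) (there x∈) (there x∈q) = x∈p─q⇒x∉q p q x∈ x∈q

x∈∁[p─q]∧x∈p⇒x∈q : {x : Fin m} (p q : Subset m) → x ∈ ∁ (p ─ q) → x ∈ p → x ∈ q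
x∈∁[p─q]∧x∈p⇒x∈q {x = x} p q x∈∁ x∈p with x ∈? q
... | yes x∈q = x∈q
... | no x∉q = contradiction (x∈p∧x∉q⇒x∈p─q x∈p x∉q) (x∈∁p⇒x∉p x∈∁)

x∈q⇒x∈∁[p─q] : {x : Fin m} (p q : Subset m) → x ∈ q → x ∈ ∁ (p ─ q)
x∈q⇒x∈∁[p─q] p q x∈q = x∉p⇒x∈∁p (λ x∈p─q → x∈p─q⇒x∉q p q x∈p─q x∈q)

∣p∪q∣≤∣p∣+∣q∣ : (p q : Subset m) → ∣ p ∪ q ∣ ≤ ∣ p ∣ + ∣ q ∣
∣p∪q∣≤∣p∣+∣q∣ [] [] = z≤n
∣p∪q∣≤∣p∣+∣q∣ (true ∷ p) (true ∷ q) =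
  s≤s (≤-trans (∣p∪q∣≤∣p∣+∣q∣ p q) (+-monoʳ-≤ _ (n≤1+n _)))
∣p∪q∣≤∣p∣+∣q∣ (true ∷ p) (false ∷ q) = s≤s (∣p∪q∣≤∣p∣+∣q∣ p q)
∣p∪q∣≤∣p∣+∣q∣ (false ∷ p) (true ∷ q) = ≤-trans (s≤s (∣p∪q∣≤∣p∣+∣q∣ p q)) (≤-reflexive (sym (+-suc _ _)))
∣p∪q∣≤∣p∣+∣q∣ (false ∷ p) (false ∷ q) = ∣p∪q∣≤∣p∣+∣q∣ p q

⊤⊆p∪q⇒n≤∣p∣+∣q∣ : (p q : Subset m) → ⊤ ⊆ p ∪ q → m ≤ ∣ p ∣ + ∣ q ∣
⊤⊆p∪q⇒n≤∣p∣+∣q∣ {m} p q ⊤⊆ = begin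
  m             ≡⟨ ∣⊤∣≡n m ⟨
  ∣ ⊤ {m} ∣     ≤⟨ p⊆q⇒∣p∣≤∣q∣ ⊤⊆ ⟩
  ∣ p ∪ q ∣     ≤⟨ ∣p∪q∣≤∣p∣+∣q∣ p q ⟩
  ∣ p ∣ + ∣ q ∣ ∎
  where open ≤-Reasoning

0<∣p∣⇒Nonempty : {p : Subset m} → 0 < ∣ p ∣ → Nonempty p
0<∣p∣⇒Nonempty {m} {p} 0<∣p∣ with nonempty? p
... | yes ne = ne
... | no empty = contradiction (trans (cong ∣_∣ (Empty-unique empty)) (∣⊥∣≡0 m)) (>⇒≢ 0<∣p∣)

⋃-map⁺ : {A : Set a} (f : A → Subset m) {x : Fin m} {y : A} {ys : List A} →
         y List.∈ ys → x ∈ f y → x ∈ ⋃ (map f ys)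
⋃-map⁺ f (Any.here refl) x∈ = x∈p∪q⁺ (inj₁ x∈)
⋃-map⁺ f (Any.there y∈) x∈ = x∈p∪q⁺ (inj₂ (⋃-map⁺ f y∈ x∈))

-- Adding the pieces one at a time, each step grows the union by fewer than α elements.
⋃-window : {A : Set a} {α : ℕ} (f : A → Subset m) → (∀ x → ∣ f x ∣ < α) →
           ∀ xs → α ≤ ∣ ⋃ (map f xs) ∣ →
           ∃ λ ys → α ≤ ∣ ⋃ (map f ys) ∣ × ∣ ⋃ (map f ys) ∣ ≤ α + α
⋃-window {m = m} f small [] α≤ = [] , α≤ , ≤-trans (≤-reflexive (∣⊥∣≡0 m)) z≤n
⋃-window {α = α} f small (x ∷ xs) α≤ with α ≤? ∣ ⋃ (map f xs) ∣
... | yes α≤rest = ⋃-window f small xs α≤rest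
... | no α≰rest = x ∷ xs , α≤ ,
  <⇒≤ (≤-trans (s≤s (∣p∪q∣≤∣p∣+∣q∣ (f x) _)) (+-mono-< (small x) (≰⇒> α≰rest)))

∃-maximal : {P : Pred (Fin m) ℓ} → Decidable P → (f : Fin m → ℕ) → ∀ {x₀} → P x₀ →
            ∃ λ t → P t × (∀ {t'} → P t' → f t' ≤ f t)
∃-maximal {m = m} P? f {x₀} px₀ =
  argmax f x₀ candidates ,
  argmax-all f px₀ (all-filter P? (allFin m)) ,
  λ pt' → All.lookup (f[xs]≤f[argmax] x₀ candidates) (∈-filter⁺ P? (∈-allFin _) pt')
  where candidates = filter P? (allFin m)

¬⊂⇒⊇ : {p q : Subset m} → p ⊆ q → ¬ p ⊂ q → q ⊆ p
¬⊂⇒⊇ {p = p} p⊆q p⊄q {x} x∈q with x ∈? p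
... | yes x∈p = x∈p
... | no x∉p = contradiction ((λ {y} → p⊆q {y}) , x , x∈q , x∉p) p⊄q

fold-preserves : {A : Set a} (P : A → Set ℓ) {f : A → A} {z : A} →
                 (∀ {R} → P R → P (f R)) → P z → ∀ i → P (fold z f i)
fold-preserves P preserved base zero = base
fold-preserves P preserved base (suc i) = preserved (fold-preserves P preserved base i)

-- Each non-stable step adds an element, so the iteration is stable after m + 1 steps.
module _ (f : Subset m → Subset m) (inflationary : ∀ {R} → R ⊆ f R)
         (monotone : ∀ {R R'} → R ⊆ R' → f R ⊆ f R') where

  fold-stable-or-large : ∀ R i → f (fold R f i) ⊆ fold R f i ⊎ i ≤ ∣ fold R f i ∣
  fold-stable-or-large R zero = inj₂ z≤n
  fold-stable-or-large R (suc i) with fold-stable-or-large R i | fold R f i ⊂? f (fold R f i)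
  ... | inj₁ stable | _ = inj₁ (monotone stable)
  ... | inj₂ large | yes grows = inj₂ (≤-trans (s≤s large) (p⊂q⇒∣p∣<∣q∣ grows))
  ... | inj₂ _ | no ¬grows = inj₁ (monotone (¬⊂⇒⊇ inflationary ¬grows))

  fold-stable : ∀ R → f (fold R f (suc m)) ⊆ fold R f (suc m)
  fold-stable R with fold-stable-or-large R (suc m)
  ... | inj₁ stable = stable
  ... | inj₂ large = contradiction (∣p∣≤n (fold R f (suc m))) (<⇒≱ large)

module _ {A : Fin m → Fin m → Set} {S : Subset m} where

  walk-head : ∀ {x y} → WalkIn A S x y → x ∈ S
  walk-head (here x∈S) = x∈S
  walk-head (step x∈S _ _) = x∈S

  walk-snoc : ∀ {x y z} → WalkIn A S x y → A y z → z ∈ S → WalkIn A S x z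
  walk-snoc (here y∈S) e z∈S = step y∈S e (here z∈S)
  walk-snoc (step x∈S e' w) e z∈S = step x∈S e' (walk-snoc w e z∈S)

  walk-++ : ∀ {x y z} → WalkIn A S x y → WalkIn A S y z → WalkIn A S x z
  walk-++ (here _) w' = w'
  walk-++ (step x∈S e w) w' = step x∈S e (walk-++ w w')

  walk-reverse : (∀ {x y} → A x y → A y x) → ∀ {x y} → WalkIn A S x y → WalkIn A S y x
  walk-reverse A-sym (here x∈S) = here x∈S
  walk-reverse A-sym (step x∈S e w) = walk-snoc (walk-reverse A-sym w) (A-sym e) x∈S

  walk-preserves : (P : Fin m → Set ℓ) → (∀ {x y} → x ∈ S → y ∈ S → A x y → P x → P y) →
                   ∀ {x y} → WalkIn A S x y → P x → P y
  walk-preserves P preserved (here _) px = px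
  walk-preserves P preserved (step x∈S e w) px =
    walk-preserves P preserved w (preserved x∈S (walk-head w) e px)

  walk-exit : {P : Fin m → Set ℓ} → Decidable P → ∀ {x y} → WalkIn A S x y → P x → ¬ P y →
              ∃ λ a → ∃ λ b → a ∈ S × b ∈ S × A a b × P a × ¬ P b
  walk-exit P? (here _) px ¬py = contradiction px ¬py
  walk-exit P? (step {y = x'} x∈S e w) px ¬py with P? x'
  ... | yes px' = walk-exit P? w px' ¬py
  ... | no ¬px' = _ , x' , x∈S , walk-head w , e , px , ¬px'

walk-mono : {A : Fin m → Fin m → Set} {S S' : Subset m} → S ⊆ S' →
            ∀ {x y} → WalkIn A S x y → WalkIn A S' x y
walk-mono S⊆S' (here x∈S) = here (S⊆S' x∈S)
walk-mono S⊆S' (step x∈S e w) = step (S⊆S' x∈S) e (walk-mono S⊆S' w)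

-- Components of induced subgraphs

module _ (G : Graph) where

  private
    V = Fin (n G)

  Edge-sym : ∀ {x y : V} → Edge G x y → Edge G y x
  Edge-sym {x} {y} e = trans (Graph.sym G y x) e

  edge? : ∀ (x y : V) → Dec (Edge G x y)
  edge? x y = adj G x y Data.Bool.≟ true

  -- Z is a union of components of G[U].
  ClosedIn : Subset (n G) → Subset (n G) → Set
  ClosedIn U Z = Z ⊆ U × (∀ {x y} → x ∈ Z → y ∈ U → Edge G x y → y ∈ Z)

  ⋃-closedIn : ∀ {a} {A : Set a} {U} (f : A → Subset (n G)) → (∀ y → ClosedIn U (f y)) →
               ∀ ys → ClosedIn U (⋃ (map f ys))
  ⋃-closedIn f closed [] = (λ x∈∅ → contradiction x∈∅ ∉⊥) , (λ x∈∅ _ _ → contradiction x∈∅ ∉⊥)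
  ⋃-closedIn f closed (y ∷ ys) = ⊆U , edge-closed
    where
    Z = f y
    Zs = ⋃ (map f ys)
    ⊆U : Z ∪ Zs ⊆ _
    ⊆U x∈ with x∈p∪q⁻ Z Zs x∈
    ... | inj₁ x∈Z = proj₁ (closed y) x∈Z
    ... | inj₂ x∈Zs = proj₁ (⋃-closedIn f closed ys) x∈Zs
    edge-closed : ∀ {x z} → x ∈ Z ∪ Zs → z ∈ _ → Edge G x z → z ∈ Z ∪ Zs
    edge-closed x∈ z∈U e with x∈p∪q⁻ Z Zs x∈
    ... | inj₁ x∈Z = x∈p∪q⁺ (inj₁ (proj₂ (closed y) x∈Z z∈U e))
    ... | inj₂ x∈Zs = x∈p∪q⁺ (inj₂ (proj₂ (⋃-closedIn f closed ys) x∈Zs z∈U e))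

  module _ (U : Subset (n G)) where

    Grows : Subset (n G) → V → Set
    Grows R y = y ∈ R ⊎ (y ∈ U × ∃ λ x → x ∈ R × Edge G x y)

    grows? : ∀ R → Decidable (Grows R)
    grows? R y = y ∈? R ⊎-dec (y ∈? U ×-dec any? λ x → x ∈? R ×-dec edge? x y)

    grow : Subset (n G) → Subset (n G)
    grow R = fromDec (grows? R)

    grow-inflationary : ∀ {R} → R ⊆ grow R
    grow-inflationary x∈R = ∈-fromDec⁺ (grows? _) (inj₁ x∈R)

    grow-monotone : ∀ {R R'} → R ⊆ R' → grow R ⊆ grow R'
    grow-monotone {R} R⊆R' y∈ with ∈-fromDec⁻ (grows? R) y∈
    ... | inj₁ y∈R = ∈-fromDec⁺ (grows? _) (inj₁ (R⊆R' y∈R))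
    ... | inj₂ (y∈U , x , x∈R , e) = ∈-fromDec⁺ (grows? _) (inj₂ (y∈U , x , R⊆R' x∈R , e))

    component : V → Subset (n G)
    component u = fold (U ∩ ⁅ u ⁆) grow (suc (n G))

    component⊆U : ∀ {u} → component u ⊆ U
    component⊆U {u} = fold-preserves (_⊆ U) grow⊆U (proj₁ ∘ x∈p∩q⁻ U ⁅ u ⁆) (suc (n G))
      where
      grow⊆U : ∀ {R} → R ⊆ U → grow R ⊆ U
      grow⊆U {R} R⊆U y∈ with ∈-fromDec⁻ (grows? R) y∈
      ... | inj₁ y∈R = R⊆U y∈R
      ... | inj₂ (y∈U , _) = y∈U

    ∈-component : ∀ {u} → u ∈ U → u ∈ component u
    ∈-component {u} u∈U =
      fold-preserves (u ∈_) grow-inflationary (x∈p∩q⁺ (u∈U , x∈⁅x⁆ u)) (suc (n G))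

    component-closedIn : ∀ {u} → ClosedIn U (component u)
    component-closedIn {u} = component⊆U , λ x∈ y∈U e →
      fold-stable grow grow-inflationary grow-monotone _
        (∈-fromDec⁺ (grows? _) (inj₂ (y∈U , _ , x∈ , e)))

    component-walk : ∀ {u x} → x ∈ component u → WalkIn (Edge G) (component u) u x
    component-walk {u} = fold-preserves WalksFromU walks-grow start (suc (n G))
      where
      WalksFromU : Subset (n G) → Set
      WalksFromU R = ∀ {x} → x ∈ R → WalkIn (Edge G) R u x
      start : WalksFromU (U ∩ ⁅ u ⁆)
      start x∈ with x∈⁅y⁆⇒x≡y u (proj₂ (x∈p∩q⁻ U ⁅ u ⁆ x∈))
      ... | refl = here x∈
      walks-grow : ∀ {R} → WalksFromU R → WalksFromU (grow R)
      walks-grow {R} walks y∈ with ∈-fromDec⁻ (grows? R) y∈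
      ... | inj₁ y∈R = walk-mono grow-inflationary (walks y∈R)
      ... | inj₂ (_ , x , x∈R , e) = walk-snoc (walk-mono grow-inflationary (walks x∈R)) e y∈

    component-connected : ∀ {u} → Nonempty (component u) → ConnectedIn (Edge G) (component u)
    component-connected nonempty = nonempty , λ x y x∈ y∈ →
      walk-++ (walk-reverse Edge-sym (component-walk x∈)) (component-walk y∈)

-- Splits and unbreakability

record Splits (G : Graph) (R P Q : Subset (n G)) : Set where
  field
    disjoint : ∀ {v} → v ∈ P → v ∉ Q
    no-edge  : ∀ {x y} → x ∈ P → y ∈ Q → ¬ Edge G x y
    covers   : ∀ {v} → v ∉ P → v ∉ Q → v ∈ R

module _ {G : Graph} {R P Q : Subset (n G)} (sp : Splits G R P Q) where

  open Splits sp

  Splits-sym : Splits G R Q P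
  Splits-sym = record
    { disjoint = λ v∈Q v∈P → disjoint v∈P v∈Q
    ; no-edge  = λ x∈Q y∈P e → no-edge y∈P x∈Q (Edge-sym G e)
    ; covers   = λ v∉Q v∉P → covers v∉P v∉Q
    }

  splits-side : ∀ {v} → v ∉ R → v ∈ P ⊎ v ∈ Q
  splits-side {v} v∉R with v ∈? P | v ∈? Q
  ... | yes v∈P | _ = inj₁ v∈P
  ... | no _ | yes v∈Q = inj₂ v∈Q
  ... | no v∉P | no v∉Q = contradiction (covers v∉P v∉Q) v∉R

  splits-closed : ∀ {x y} → x ∈ P → Edge G x y → y ∉ R → y ∈ P
  splits-closed x∈P e y∉R with splits-side y∉R
  ... | inj₁ y∈P = y∈P
  ... | inj₂ y∈Q = contradiction e (no-edge x∈P y∈Q)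

  connected⊆side : ∀ {K x} → ConnectedIn (Edge G) K → (∀ {y} → y ∈ K → y ∉ R) →
                   x ∈ K → x ∈ P → K ⊆ P
  connected⊆side (_ , walks) avoid x∈K x∈P y∈K =
    walk-preserves (_∈ P) (λ _ b∈K e a∈P → splits-closed a∈P e (avoid b∈K)) (walks _ _ x∈K y∈K) x∈P

-- (∁ Q , ∁ P) is a separation whose separator lies in R.
unbreakable-splits : ∀ {α k} {G : Graph} {R P Q} → Unbreakable α k G → Splits G R P Q →
                     ∣ R ∣ ≤ k → α ≤ ∣ P ∣ → ∣ Q ∣ < α
unbreakable-splits {α} {k} {G} {R} {P} {Q} unbreakable sp ∣R∣≤k α≤∣P∣ = ≰⇒> λ α≤∣Q∣ →
  unbreakable (∁ Q , ∁ P , (cover , no-cross) , separator≤k ,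
               ≤-trans α≤∣P∣ (p⊆q⇒∣p∣≤∣q∣ P⊆) , ≤-trans α≤∣Q∣ (p⊆q⇒∣p∣≤∣q∣ Q⊆))
  where
  open Splits sp
  cover : ∀ v → v ∈ ∁ Q ∪ ∁ P
  cover v with v ∈? Q
  ... | yes v∈Q = x∈p∪q⁺ (inj₂ (x∉p⇒x∈∁p λ v∈P → disjoint v∈P v∈Q))
  ... | no v∉Q = x∈p∪q⁺ (inj₁ (x∉p⇒x∈∁p v∉Q))
  no-cross : ∀ x y → x ∈ ∁ Q ─ ∁ P → y ∈ ∁ P ─ ∁ Q → ¬ Edge G x y
  no-cross x y x∈ y∈ = no-edge (x∉∁p⇒x∈p (x∈p─q⇒x∉q (∁ Q) (∁ P) x∈))
                               (x∉∁p⇒x∈p (x∈p─q⇒x∉q (∁ P) (∁ Q) y∈))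
  separator≤k : ∣ ∁ Q ∩ ∁ P ∣ ≤ k
  separator≤k = ≤-trans (p⊆q⇒∣p∣≤∣q∣ λ v∈ → let v∈∁Q , v∈∁P = x∈p∩q⁻ (∁ Q) (∁ P) v∈
                                             in covers (x∈∁p⇒x∉p v∈∁P) (x∈∁p⇒x∉p v∈∁Q)) ∣R∣≤k
  P⊆ : P ⊆ ∁ Q ─ ∁ P
  P⊆ v∈P = x∈p∧x∉q⇒x∈p─q (x∉p⇒x∈∁p (disjoint v∈P)) (x∈p⇒x∉∁p v∈P)
  Q⊆ : Q ⊆ ∁ P ─ ∁ Q
  Q⊆ v∈Q = x∈p∧x∉q⇒x∈p─q (x∉p⇒x∈∁p λ v∈P → disjoint v∈P v∈Q) (x∈p⇒x∉∁p v∈Q)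

unbreakable⇒0<α : ∀ {α k} {G : Graph} → Unbreakable α k G → 0 < α
unbreakable⇒0<α {zero} {k} {G} unbreakable =
  contradiction (unbreakable-splits unbreakable everything-vs-∅ ∣∅∣≤k z≤n) n≮0
  where
  everything-vs-∅ : Splits G ∅ ⊤ ∅
  everything-vs-∅ = record
    { disjoint = λ _ → ∉⊥
    ; no-edge  = λ _ y∈∅ → contradiction y∈∅ ∉⊥
    ; covers   = λ v∉⊤ → contradiction ∈⊤ v∉⊤
    }
  ∣∅∣≤k : ∣ ∅ {n G} ∣ ≤ k
  ∣∅∣≤k = subst (_≤ k) (sym (∣⊥∣≡0 (n G))) z≤n
unbreakable⇒0<α {suc α} _ = s≤s z≤n

3α+k≤3[α+k] : ∀ α k → α + α + α + k ≤ 3 * (α + k)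
3α+k≤3[α+k] α k = subst (α + α + α + k ≤_) (expand α k) (m≤m+n (α + α + α + k) (k + k))
  where
  expand : ∀ α k → α + α + α + k + (k + k) ≡ 3 * (α + k)
  expand = solve-∀

-- Greedily merging components of size < α yields a union Z with α ≤ ∣ Z ∣ ≤ 2α;
-- the rest of G - S is then too large for unbreakability.
∃-large-component : ∀ {α k} {G : Graph} {S : Subset (n G)} → Unbreakable α k G → ∣ S ∣ ≤ k →
                    3 * (α + k) < n G → ∃ λ u → α ≤ ∣ component G (∁ S) u ∣
∃-large-component {α} {k} {G} {S} unbreakable ∣S∣≤k big
  with any? (λ u → α ≤? ∣ component G (∁ S) u ∣)
... | yes large = large
... | no none = contradiction (≤-trans everything-counted (3α+k≤3[α+k] α k)) (<⇒≱ big)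
  where
  U : Subset (n G)
  U = ∁ S
  comp : Fin (n G) → Subset (n G)
  comp = component G U
  α≤∣U∣ : α ≤ ∣ U ∣
  α≤∣U∣ = subst (α ≤_) (sym (∣∁p∣≡n∸∣p∣ S))
            (m+n≤o⇒m≤o∸n α (≤-trans (+-monoʳ-≤ α ∣S∣≤k) (≤-trans (m≤m+n (α + k) _) (<⇒≤ big))))
  U⊆⋃ : U ⊆ ⋃ (map comp (allFin (n G)))
  U⊆⋃ {u} u∈U = ⋃-map⁺ comp (∈-allFin u) (∈-component G U u∈U)
  window : ∃ λ us → α ≤ ∣ ⋃ (map comp us) ∣ × ∣ ⋃ (map comp us) ∣ ≤ α + α
  window = ⋃-window comp (λ u → ≰⇒> λ α≤ → none (u , α≤)) (allFin (n G))
                     (≤-trans α≤∣U∣ (p⊆q⇒∣p∣≤∣q∣ U⊆⋃))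
  Z : Subset (n G)
  Z = ⋃ (map comp (proj₁ window))
  Z-closed : ClosedIn G U Z
  Z-closed = ⋃-closedIn G comp (λ _ → component-closedIn G U) (proj₁ window)
  rest : Subset (n G)
  rest = U ─ Z
  splits : Splits G S Z rest
  splits = record
    { disjoint = λ v∈Z v∈rest → x∈p─q⇒x∉q U Z v∈rest v∈Z
    ; no-edge  = λ x∈Z y∈rest e → x∈p─q⇒x∉q U Z y∈rest (proj₂ Z-closed x∈Z (p─q⊆p U Z y∈rest) e)
    ; covers   = λ v∉Z v∉rest → x∉∁p⇒x∈p λ v∈U → v∉rest (x∈p∧x∉q⇒x∈p─q v∈U v∉Z)
    }
  ∣rest∣<α : ∣ rest ∣ < α
  ∣rest∣<α = unbreakable-splits unbreakable splits ∣S∣≤k (proj₁ (proj₂ window))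
  everything-counted : n G ≤ α + α + α + k
  everything-counted = begin
    n G                       ≤⟨ ⊤⊆p∪q⇒n≤∣p∣+∣q∣ (Z ∪ rest) S Z∪rest∪S ⟩
    ∣ Z ∪ rest ∣ + ∣ S ∣      ≤⟨ +-monoˡ-≤ _ (∣p∪q∣≤∣p∣+∣q∣ Z rest) ⟩
    ∣ Z ∣ + ∣ rest ∣ + ∣ S ∣  ≤⟨ +-mono-≤ (+-mono-≤ (proj₂ (proj₂ window)) (<⇒≤ ∣rest∣<α)) ∣S∣≤k ⟩
    α + α + α + k             ∎
    where
    open ≤-Reasoning
    Z∪rest∪S : ⊤ ⊆ (Z ∪ rest) ∪ S
    Z∪rest∪S {v} _ with v ∈? S | v ∈? Z
    ... | yes v∈S | _ = x∈p∪q⁺ (inj₂ v∈S)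
    ... | no _ | yes v∈Z = x∈p∪q⁺ (inj₁ (x∈p∪q⁺ (inj₁ v∈Z)))
    ... | no v∉S | no v∉Z = x∈p∪q⁺ (inj₁ (x∈p∪q⁺ (inj₂ (x∈p∧x∉q⇒x∈p─q (x∉p⇒x∈∁p v∉S) v∉Z))))

-- Subtrees of a rooted tree

module Subtrees (T : RootedTree) where

  Node = Fin (size T)

  -- s ≼ x: x lies in the subtree rooted at s.
  _≼_ : Node → Node → Set
  s ≼ x = ∃ λ j → iterate (parent T) x j ≡ s

  ≼-refl : ∀ {x} → x ≼ x
  ≼-refl = 0 , refl

  ≼-down : ∀ {s x} → s ≼ parent T x → s ≼ x
  ≼-down (j , e) = suc j , e

  ≼-up : ∀ {s x} → x ≢ s → s ≼ x → s ≼ parent T x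
  ≼-up x≢s (zero , e) = contradiction e x≢s
  ≼-up x≢s (suc j , e) = j , e

  iterate-root : ∀ j → iterate (parent T) (root T) j ≡ root T
  iterate-root zero = refl
  iterate-root (suc j) rewrite root-parent T = iterate-root j

  depth≡0⇒root : ∀ {x} → depth T x ≡ 0 → x ≡ root T
  depth≡0⇒root {x} d≡0 with x ≟ root T
  ... | yes x≡root = x≡root
  ... | no x≢root = contradiction (subst (depth T (parent T x) <_) d≡0 (depth-dec T x x≢root)) n≮0

  iterate-beyond-depth : ∀ j x → depth T x ≤ j → iterate (parent T) x j ≡ root T
  iterate-beyond-depth zero x d≤0 = depth≡0⇒root (n≤0⇒n≡0 d≤0)
  iterate-beyond-depth (suc j) x d≤ with x ≟ root T
  ... | yes refl = iterate-root (suc j)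
  ... | no x≢root =
    iterate-beyond-depth j (parent T x) (≤-pred (≤-trans (depth-dec T x x≢root) d≤))

  root≼ : ∀ x → root T ≼ x
  root≼ x = depth T x , iterate-beyond-depth (depth T x) x ≤-refl

  ≼-bounded : ∀ {s x} → s ≼ x → ∃ λ j → j < suc (depth T x) × iterate (parent T) x j ≡ s
  ≼-bounded {s} {x} (j , e) with j ≤? depth T x
  ... | yes j≤d = j , s≤s j≤d , e
  ... | no j≰d = depth T x , ≤-refl ,
    trans (iterate-beyond-depth _ x ≤-refl) (trans (sym (iterate-beyond-depth j x (<⇒≤ (≰⇒> j≰d)))) e)

  _≼?_ : ∀ s x → Dec (s ≼ x)
  s ≼? x = map′ (λ (j , _ , e) → j , e) ≼-bounded
                (anyUpTo? (λ j → iterate (parent T) x j ≟ s) (suc (depth T x)))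

  leaving-subtree : ∀ {s a b} → TreeAdj T a b → s ≼ a → ¬ s ≼ b → a ≡ s × parent T s ≡ b
  leaving-subtree {s} (inj₂ (_ , pb≡a)) s≼a s⋠b =
    contradiction (≼-down (subst (s ≼_) (sym pb≡a) s≼a)) s⋠b
  leaving-subtree {s} {a} (inj₁ (_ , pa≡b)) s≼a s⋠b with a ≟ s
  ... | yes refl = refl , pa≡b
  ... | no a≢s = contradiction (subst (s ≼_) pa≡b (≼-up a≢s s≼a)) s⋠b

  child-toward : ∀ {s b} → s ≼ b → b ≢ s → ∃ λ c → parent T c ≡ s × c ≢ root T × c ≼ b
  child-toward {s} (j , e) = along j e
    where
    along : ∀ j {b} → iterate (parent T) b j ≡ s → b ≢ s →
            ∃ λ c → parent T c ≡ s × c ≢ root T × c ≼ b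
    along zero e b≢s = contradiction e b≢s
    along (suc j) {b} e b≢s with parent T b ≟ s
    ... | yes pb≡s = b , pb≡s , b≢root , ≼-refl
      where
      b≢root : b ≢ root T
      b≢root refl = b≢s (trans (sym (root-parent T)) pb≡s)
    ... | no pb≢s with along j e pb≢s
    ...   | c , pc≡s , c≢root , c≼pb = c , pc≡s , c≢root , ≼-down c≼pb

-- Cutting an ℋ-tree decomposition at a tree edge

module Cut {ℋ : Graph → Set} {G : Graph} (D : HTreeDecomposition ℋ G) where

  open Subtrees (tree D)

  private
    V = Fin (n G)
    T = tree D

  bagsOf : V → Subset (size T)
  bagsOf v = tabulate λ t → lookup (χ D t) v

  ∈-bagsOf⁺ : ∀ {v t} → v ∈ χ D t → t ∈ bagsOf v
  ∈-bagsOf⁺ v∈t = ∈-tabulate⁺ ([]=⇒lookup v∈t)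

  ∈-bagsOf⁻ : ∀ {v t} → t ∈ bagsOf v → v ∈ χ D t
  ∈-bagsOf⁻ {v} {t} t∈ = lookup⇒[]= v (χ D t) (∈-tabulate⁻ t∈)

  some-bag : ∀ v → ∃ λ t → v ∈ χ D t
  some-bag v = let t , t∈ = proj₁ (vertex-connected D v) in t , ∈-bagsOf⁻ t∈

  BagIn BagOut : Node → V → Set
  BagIn s v = ∃ λ t → v ∈ χ D t × s ≼ t
  BagOut s v = ∃ λ t → v ∈ χ D t × ¬ s ≼ t

  bagIn? : ∀ s → Decidable (BagIn s)
  bagIn? s v = any? λ t → v ∈? χ D t ×-dec s ≼? t

  bagOut? : ∀ s → Decidable (BagOut s)
  bagOut? s v = any? λ t → v ∈? χ D t ×-dec ¬? (s ≼? t)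

  -- The vertices all of whose bags lie inside, resp. outside, the subtree of s.
  inside outside : Node → Subset (n G)
  inside s = ∁ (fromDec (bagOut? s))
  outside s = ∁ (fromDec (bagIn? s))

  inside⁺ : ∀ {s v} → ¬ BagOut s v → v ∈ inside s
  inside⁺ ¬out = x∉p⇒x∈∁p (¬out ∘ ∈-fromDec⁻ (bagOut? _))

  inside⁻ : ∀ {s v} → v ∈ inside s → ¬ BagOut s v
  inside⁻ v∈ out = x∈∁p⇒x∉p v∈ (∈-fromDec⁺ (bagOut? _) out)

  outside⁻ : ∀ {s v} → v ∈ outside s → ¬ BagIn s v
  outside⁻ v∈ in' = x∈∁p⇒x∉p v∈ (∈-fromDec⁺ (bagIn? _) in')

  ∉inside : ∀ {s v} → v ∉ inside s → BagOut s v
  ∉inside v∉ = ∈-fromDec⁻ (bagOut? _) (x∉∁p⇒x∈p v∉)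

  ∉outside : ∀ {s v} → v ∉ outside s → BagIn s v
  ∉outside v∉ = ∈-fromDec⁻ (bagIn? _) (x∉∁p⇒x∈p v∉)

  inside-bag : ∀ {s v t} → v ∈ inside s → v ∈ χ D t → s ≼ t
  inside-bag {s} {t = t} v∈ v∈t with s ≼? t
  ... | yes s≼t = s≼t
  ... | no s⋠t = contradiction (t , v∈t , s⋠t) (inside⁻ v∈)

  n≤∣inside-root∣ : n G ≤ ∣ inside (root T) ∣
  n≤∣inside-root∣ = subst (_≤ ∣ inside (root T) ∣) (∣⊤∣≡n (n G))
    (p⊆q⇒∣p∣≤∣q∣ {p = ⊤} λ _ → inside⁺ λ (t , _ , root⋠t) → root⋠t (root≼ t))

  no-common-bag : ∀ {s x y t} → x ∈ inside s → y ∈ outside s → x ∈ χ D t → y ∈ χ D t → ⊥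
  no-common-bag {s} {t = t} x∈ y∈ x∈t y∈t with s ≼? t
  ... | yes s≼t = outside⁻ y∈ (t , y∈t , s≼t)
  ... | no s⋠t = inside⁻ x∈ (t , x∈t , s⋠t)

  adhesion : Node → Subset (n G)
  adhesion s = χ D s ∩ χ D (parent T s)

  adhesion─L⁻ : ∀ {s v} → v ∈ adhesion s ─ L D → v ∈ χ D s × v ∈ χ D (parent T s)
  adhesion─L⁻ {s} v∈ = x∈p∩q⁻ (χ D s) _ (p─q⊆p (adhesion s) (L D) v∈)

  ∣adhesion─L∣≤∣bag─L∣ : ∀ s → ∣ adhesion s ─ L D ∣ ≤ ∣ χ D s ─ L D ∣
  ∣adhesion─L∣≤∣bag─L∣ s = p⊆q⇒∣p∣≤∣q∣ λ v∈ →
    x∈p∧x∉q⇒x∈p─q (proj₁ (adhesion─L⁻ v∈)) (x∈p─q⇒x∉q (adhesion s) (L D) v∈)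

  -- The bags of v form a subtree, which meets the subtree of s and its complement,
  -- so it contains the tree edge from s to its parent; and v ∉ L as v has two bags.
  straddle : ∀ {s v} → BagIn s v → BagOut s v → v ∈ adhesion s ─ L D
  straddle {s} {v} (t₁ , v∈t₁ , s≼t₁) (t₂ , v∈t₂ , s⋠t₂)
    with walk-exit (s ≼?_) (proj₂ (vertex-connected D v) t₁ t₂ (∈-bagsOf⁺ v∈t₁) (∈-bagsOf⁺ v∈t₂))
                   s≼t₁ s⋠t₂
  ... | a , b , a∈ , b∈ , a~b , s≼a , s⋠b with leaving-subtree a~b s≼a s⋠b
  ...   | refl , refl = x∈p∧x∉q⇒x∈p─q (x∈p∩q⁺ (∈-bagsOf⁻ a∈ , ∈-bagsOf⁻ b∈)) v∉L
    where
    v∉L : v ∉ L D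
    v∉L v∈L with L-leaf D v v∈L
    ... | _ , _ , _ , unique =
      s⋠t₂ (subst (s ≼_) (trans (unique t₁ v∈t₁) (sym (unique t₂ v∈t₂))) s≼t₁)

  cut-splits : ∀ s → Splits G (adhesion s ─ L D) (inside s) (outside s)
  cut-splits s = record
    { disjoint = λ {v} v∈in v∈out → let t , v∈t = some-bag v in no-common-bag v∈in v∈out v∈t v∈t
    ; no-edge  = λ x∈in y∈out e → let t , x∈t , y∈t = edge-covered D _ _ e in
                                   no-common-bag x∈in y∈out x∈t y∈t
    ; covers   = λ v∉in v∉out → straddle (∉outside v∉out) (∉inside v∉in)
    }

  L-neighbour∈bag : ∀ {x y t} → x ∈ L D → x ∈ χ D t → Edge G x y → y ∈ χ D t
  L-neighbour∈bag {x} {y} {t} x∈L x∈t e with L-leaf D x x∈L | edge-covered D x y e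
  ... | _ , _ , _ , unique | t' , x∈t' , y∈t' =
    subst (λ t → y ∈ χ D t) (trans (unique t' x∈t') (sym (unique t x∈t))) y∈t'

  component-meeting-bag : ∀ {t K w} → ClosedIn G (∁ (χ D t ─ L D)) K →
                          ConnectedIn (Edge G) K → w ∈ K → w ∈ χ D t → IsComponentOf G (L D) K
  component-meeting-bag {t} {K} (K⊆U , K-closed) connected@(_ , walks) w∈K w∈t =
    K⊆L , connected , λ _ y x∈K y∈L e → K-closed x∈K (x∈q⇒x∈∁[p─q] (χ D t) (L D) y∈L) e
    where
    ∈L : ∀ {x} → x ∈ K → x ∈ χ D t → x ∈ L D
    ∈L x∈K = x∈∁[p─q]∧x∈p⇒x∈q (χ D t) (L D) (K⊆U x∈K)
    K⊆χt : K ⊆ χ D t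
    K⊆χt x∈K = walk-preserves (_∈ χ D t) (λ a∈K _ e a∈t → L-neighbour∈bag (∈L a∈K a∈t) a∈t e)
                              (walks _ _ w∈K x∈K) w∈t
    K⊆L : K ⊆ L D
    K⊆L x∈K = ∈L x∈K (K⊆χt x∈K)

  connected-avoiding-bag : ∀ {t K} → ConnectedIn (Edge G) K → (∀ {x} → x ∈ K → x ∉ χ D t) →
                           K ⊆ outside t ⊎ ∃ λ c → parent T c ≡ t × c ≢ root T × K ⊆ inside c
  connected-avoiding-bag {t} {K} connected@((x , x∈K) , _) avoid
    with splits-side (cut-splits t) (avoid x∈K ∘ proj₁ ∘ adhesion─L⁻)
  ... | inj₂ x∈out = inj₁ (connected⊆side (Splits-sym (cut-splits t)) connected avoid-t x∈K x∈out)
    where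
    avoid-t : ∀ {y} → y ∈ K → y ∉ adhesion t ─ L D
    avoid-t y∈K = avoid y∈K ∘ proj₁ ∘ adhesion─L⁻
  ... | inj₁ x∈in with some-bag x
  ...   | b , x∈b with child-toward (inside-bag x∈in x∈b) (λ { refl → avoid x∈K x∈b })
  ...     | c , pc≡t , c≢root , c≼b =
    inj₂ (c , pc≡t , c≢root , connected⊆side (cut-splits c) connected avoid-c x∈K x∈c)
    where
    avoid-c : ∀ {y} → y ∈ K → y ∉ adhesion c ─ L D
    avoid-c y∈K = avoid y∈K ∘ subst (λ p → _ ∈ χ D p) pc≡t ∘ proj₂ ∘ adhesion─L⁻
    x∈c : x ∈ inside c
    x∈c with splits-side (cut-splits c) (avoid-c x∈K)
    ... | inj₁ x∈in-c = x∈in-c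
    ... | inj₂ x∈out-c = contradiction (b , x∈b , c≼b) (outside⁻ x∈out-c)

  large-component-in-L : ∀ {α t K} → ClosedIn G (∁ (χ D t ─ L D)) K → ConnectedIn (Edge G) K →
                         α ≤ ∣ K ∣ → ∣ outside t ∣ < α →
                         (∀ {c} → parent T c ≡ t → c ≢ root T → ∣ inside c ∣ < α) →
                         IsComponentOf G (L D) K
  large-component-in-L {α} {t} {K} closed connected α≤∣K∣ small-outside small-children
    with any? (λ w → w ∈? K ×-dec w ∈? χ D t)
  ... | yes (w , w∈K , w∈t) = component-meeting-bag closed connected w∈K w∈t
  ... | no disjoint with connected-avoiding-bag connected (λ x∈K x∈t → disjoint (_ , x∈K , x∈t))
  ...   | inj₁ K⊆out = contradiction (≤-trans α≤∣K∣ (p⊆q⇒∣p∣≤∣q∣ K⊆out)) (<⇒≱ small-outside)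
  ...   | inj₂ (c , pc≡t , c≢root , K⊆in) =
    contradiction (≤-trans α≤∣K∣ (p⊆q⇒∣p∣≤∣q∣ K⊆in)) (<⇒≱ (small-children pc≡t c≢root))

m∸1≤n∸1⇒m≤n : ∀ m {n} → 1 ≤ n → m ∸ 1 ≤ n ∸ 1 → m ≤ n
m∸1≤n∸1⇒m≤n zero _ _ = z≤n
m∸1≤n∸1⇒m≤n (suc m) {suc n} _ m≤n = s≤s m≤n

mainTheorem7 : (ℋ : Graph → Set) → Hereditary ℋ → (k : ℕ) → 2 ≤ k → (α : ℕ → ℕ)
    → (G : Graph) → Unbreakable (α k) k G → 3 * (α k + k) < n G
    → (D : HTreeDecomposition ℋ G) → WidthAtMost D (k ∸ 1)
    → Σ (Subset (n G)) λ C → IsComponentOf G (L D) C × α k ≤ ∣ C ∣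
mainTheorem7 ℋ _ k 2≤k α G unbreakable big D width =
  let open Cut D
      T = tree D
      narrow : ∀ t → ∣ χ D t ─ L D ∣ ≤ k
      narrow t = m∸1≤n∸1⇒m≤n _ (≤-trans (s≤s z≤n) 2≤k) (width t)
      α≤n : α k ≤ n G
      α≤n = ≤-trans (m≤m+n (α k) k) (≤-trans (m≤m+n (α k + k) _) (<⇒≤ big))
      t , α≤∣inside-t∣ , deepest =
        ∃-maximal (λ t → α k ≤? ∣ inside t ∣) (depth T) (≤-trans α≤n n≤∣inside-root∣)
      outside-small : ∣ outside t ∣ < α k
      outside-small = unbreakable-splits unbreakable (cut-splits t)
                        (≤-trans (∣adhesion─L∣≤∣bag─L∣ t) (narrow t)) α≤∣inside-t∣
      children-small : ∀ {c} → parent T c ≡ t → c ≢ root T → ∣ inside c ∣ < α k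
      children-small {c} pc≡t c≢root = ≰⇒> λ α≤ →
        <⇒≱ (subst (λ p → depth T p < depth T c) pc≡t (depth-dec T c c≢root)) (deepest α≤)
      S : Subset (n G)
      S = χ D t ─ L D
      u , α≤∣K∣ = ∃-large-component {α k} {k} {G} {S} unbreakable (narrow t) big
      K-nonempty : Nonempty (component G (∁ S) u)
      K-nonempty = 0<∣p∣⇒Nonempty (≤-trans (unbreakable⇒0<α {α k} {k} {G} unbreakable) α≤∣K∣)
      K-component : IsComponentOf G (L D) (component G (∁ S) u)
      K-component = large-component-in-L (component-closedIn G (∁ S))
                      (component-connected G (∁ S) K-nonempty) α≤∣K∣ outside-small children-small
  in component G (∁ S) u , K-component , α≤∣K∣
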